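{- There exist a discrete probability distribution $P=(a_1/m,\dots,a_n/m)$ (with $a_i$ coprime positive integers, $m=\sum a_i$) and an integer $K\ge\lceil\log m\rceil$ such that $\tau(\mathrm{ALDR}[P,K])<\tau(\mathrm{ALDR}[P,K+1])$.
   Context: All logarithms are base 2; $H$ is Shannon entropy. For real $x\ge0$ and integer $d$, $\epsilon_d(x)=\lfloor2^dx\rfloor\bmod2$, $\nu(x)=\sum_dd\,\epsilon_d(x)2^{ -d}$. A DDG tree is a sampler driven by i.i.d. fair bits (binary tree with labeled leaves, possibly with back edges to the root); $C(T)$ is the number of bits consumed and $\tau(T)=\mathbb{E}[C(T)]-H(P_T)$, $P_T$ the output distribution. FLDR: for positive integers $A_1,\dots,A_n$ with sum $M$, $K'=\lceil\log M\rceil$, $A_0=2^{K'}-M$, $Q=(A_0/2^{K'},\dots,A_n/2^{K'})$; $\mathrm{FLDR}[A_1,\dots,A_n]$ is an entropy-optimal DDG tree for $Q$ (exactly $\epsilon_d(A_i/2^{K'})$ leaves labeled $i$ at depth $d$) with every leaf labeled $0$ replaced by a back edge to the root; output distribution $(A_i/M)$, expected cost $(2^{K'}/M)\sum_{i=0}^n\nu(A_i/2^{K'})$. ALDR: $c_K=\lfloor2^K/m\rfloor$, $\mathrm{ALDR}[P,K]=\mathrm{FLDR}[c_Ka_1,\dots,c_Ka_n]$. -}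

module Defs where

open import Data.Nat as ℕ using (ℕ; zero; suc; _+_; _*_; _∸_; _^_; _≤_)
open import Data.Nat.DivMod using (_/_; _%_)
open import Data.Nat.GCD using (gcd)
open import Data.Nat.Logarithm using (⌈log₂_⌉)
open import Data.Integer using (+_)
open import Data.Rational as ℚ using (ℚ; 0ℚ)
open import Data.Vec using (Vec; []; _∷_; foldr)

pow2 : ℕ → ℕ
pow2 k = 2 ^ k

_ℚ/_ : ℕ → ℕ → ℚ
p ℚ/ zero = 0ℚ          -- never used with denominator 0 in the statement
p ℚ/ suc q = (+ p) ℚ./ suc q

epsilon : ℕ → ℕ → ℕ → ℕ
epsilon d A k with pow2 k in eq
... | zero  = 0          -- impossible: 2^k > 0
... | suc q = ((pow2 d * A) / suc q) % 2

-- ν(A / 2^k) = Σ_{d ≥ 1} d ε_d(A/2^k) 2^{-d}.  For 0 ≤ A ≤ 2^k (the only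
-- case used) the terms with d > k vanish, and terms with d ≤ 0 vanish
-- (d = 0 has weight 0; d < 0 has ε_d = 0 since A/2^k ≤ 1).
nuSum : ℕ → ℕ → ℕ → ℚ
nuSum zero    A k = 0ℚ
nuSum (suc d) A k = nuSum d A k ℚ.+ ((suc d * epsilon (suc d) A k) ℚ/ pow2 (suc d))

nu : ℕ → ℕ → ℚ
nu A k = nuSum k A k

sumV : ∀ {n} → Vec ℕ n → ℕ
sumV = foldr _ _+_ 0

gcdV : ∀ {n} → Vec ℕ n → ℕ
gcdV = foldr _ gcd 0

mapV : ∀ {n} → (ℕ → ℕ) → Vec ℕ n → Vec ℕ n
mapV f [] = []
mapV f (x ∷ xs) = f x ∷ mapV f xs

sumνV : ∀ {n} → Vec ℕ n → ℕ → ℚ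
sumνV [] k = 0ℚ
sumνV (x ∷ xs) k = nu x k ℚ.+ sumνV xs k

fldrCost : ∀ {n} → Vec ℕ n → ℚ
fldrCost {n} As =
  let M  = sumV As
      K' = ⌈log₂ M ⌉
      A₀ = pow2 K' ∸ M
  in (pow2 K' ℚ/ M) ℚ.* (nu A₀ K' ℚ.+ sumνV As K')

cK : ℕ → ℕ → ℕ
cK K zero = 0
cK K (suc m) = pow2 K / suc m

aldrCost : ∀ {n} → Vec ℕ n → ℕ → ℚ
aldrCost as K = fldrCost (mapV (cK K (sumV as) *_) as)

data AllPos : ∀ {n} → Vec ℕ n → Set where
  []  : AllPos []
  _∷_ : ∀ {n x} {xs : Vec ℕ n} → 1 ≤ x → AllPos xs → AllPos (x ∷ xs)

{-# OPTIONS --safe #-}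
module Submission where

-- The witness is P = (1/5, 4/5) with K = 6. Since c₆ = 12 and c₇ = 25,
-- ALDR[P,6] = FLDR[12,48] and ALDR[P,7] = FLDR[25,100]. Reading off binary
-- expansions, FLDR[12,48] costs (64/60)(ν(4/64) + ν(12/64) + ν(48/64))
-- = (64/60)(1/4 + 5/8 + 1) = 2 bits, while FLDR[25,100] costs
-- (128/125)(ν(3/128) + ν(25/128) + ν(100/128)) = 254/125 bits. Both samplers
-- have output distribution P, so τ increases by 4/125 from K = 6 to K = 7.

open import Defs
open import Data.Nat using (ℕ; _≤_; suc; s≤s; z≤n)
open import Data.Nat.Logarithm using (⌈log₂_⌉)
open import Data.Nat.Properties using (≤ᵇ⇒≤)
open import Data.Integer using (+_)
open import Data.Vec using (Vec; []; _∷_)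
open import Data.Product using (Σ; _×_; _,_)
open import Data.Rational using (_<_; _<?_; _/_)
open import Relation.Nullary.Decidable using (toWitness)
open import Relation.Binary.PropositionalEquality using (_≡_; refl; sym; trans; subst₂)

oneFifthFourFifths : Vec ℕ 2
oneFifthFourFifths = 1 ∷ 4 ∷ []

aldr-oneFifthFourFifths-6 : aldrCost oneFifthFourFifths 6 ≡ fldrCost (12 ∷ 48 ∷ [])
aldr-oneFifthFourFifths-6 = refl

aldr-oneFifthFourFifths-7 : aldrCost oneFifthFourFifths 7 ≡ fldrCost (25 ∷ 100 ∷ [])
aldr-oneFifthFourFifths-7 = refl

fldrCost-12-48 : fldrCost (12 ∷ 48 ∷ []) ≡ + 2 / 1
fldrCost-12-48 = refl

fldrCost-25-100 : fldrCost (25 ∷ 100 ∷ []) ≡ + 254 / 125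
fldrCost-25-100 = refl

2<254/125 : + 2 / 1 < + 254 / 125
2<254/125 = toWitness {a? = + 2 / 1 <? + 254 / 125} _

proposition5p10 : Σ ℕ λ n → Σ (Vec ℕ n) λ a →
    AllPos a × gcdV a ≡ 1 ×
    (Σ ℕ λ K → ⌈log₂ sumV a ⌉ ≤ K ×
    aldrCost a K < aldrCost a (suc K))
proposition5p10 =
  2 , oneFifthFourFifths , s≤s z≤n ∷ s≤s z≤n ∷ [] , refl ,
  6 , ≤ᵇ⇒≤ 3 6 _ , cost-increases
  where
  cost-increases : aldrCost oneFifthFourFifths 6 < aldrCost oneFifthFourFifths 7
  cost-increases =
    subst₂ _<_ (sym (trans aldr-oneFifthFourFifths-6 fldrCost-12-48))
               (sym (trans aldr-oneFifthFourFifths-7 fldrCost-25-100))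
               2<254/125
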